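{- For every positive integer $n$ which is a triangular number (i.e. $n=\frac{j(j+1)}{2}$ for some $j\in\mathbb{N}$) and also satisfies $n=j'(3j'\pm 2)$ for some $j'\in\mathbb{Z}$, we have $\operatorname{sc}_3(n)=\operatorname{c}_2(n)=1$.
   Context: A partition is a $t$-core if no hook length $h(j,k)=\lambda_j+\lambda'_k-j-k+1$ of a cell of its Ferrers--Young diagram is divisible by $t$, and self-conjugate if it equals its conjugate. $\operatorname{c}_t(n)$ is the number of $t$-core partitions of $n$ and $\operatorname{sc}_t(n)$ the number of self-conjugate $t$-core partitions of $n$. -}

module Defs where

open import Data.Nat using (ℕ; zero; suc; _+_; _∸_; _≤_; _<_; _≥_; _≤?_)
open import Data.Nat.Divisibility using (_∣_)
open import Data.List using (List; []; _∷_; length; filter; applyUpTo)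
open import Data.Nat.ListAction using (sum)
open import Data.List.Relation.Unary.All using (All)
open import Data.List.Relation.Unary.Linked using (Linked)
open import Data.Product using (Σ; _×_)
open import Relation.Nullary using (¬_)
open import Relation.Binary.PropositionalEquality using (_≡_)

IsPartitionOf : List ℕ → ℕ → Set
IsPartitionOf λs n = Linked _≥_ λs × All (0 <_) λs × sum λs ≡ n

-- λ_j, 1-indexed; 0 outside the range 1..ℓ
part : List ℕ → ℕ → ℕ
part []       _             = 0
part (x ∷ xs) zero          = 0
part (x ∷ xs) (suc zero)    = x
part (x ∷ xs) (suc (suc j)) = part xs (suc j)

conjPart : List ℕ → ℕ → ℕ
conjPart λs k = length (filter (k ≤?_) λs)

conjugate : List ℕ → List ℕ
conjugate λs = applyUpTo (λ i → conjPart λs (suc i)) (part λs 1)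

-- hook length h(j,k) = λ_j + λ'_k - j - k + 1 (nonnegative on cells)
hook : List ℕ → ℕ → ℕ → ℕ
hook λs j k = (part λs j + conjPart λs k + 1) ∸ (j + k)

IsTCore : ℕ → List ℕ → Set
IsTCore t λs = ∀ j k → 1 ≤ j → 1 ≤ k → k ≤ part λs j → ¬ (t ∣ hook λs j k)

IsSelfConjugate : List ℕ → Set
IsSelfConjugate λs = conjugate λs ≡ λs

ExactlyOne : ℕ → (List ℕ → Set) → Set
ExactlyOne n P = Σ (List ℕ) λ μ → (IsPartitionOf μ n × P μ)
                   × (∀ ν → IsPartitionOf ν n → P ν → ν ≡ μ)

cEqOne : ℕ → ℕ → Set
cEqOne t n = ExactlyOne n (IsTCore t)

scEqOne : ℕ → ℕ → Set
scEqOne t n = ExactlyOne n (λ μ → IsTCore t μ × IsSelfConjugate μ)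

-- A 2-core is a staircase (r, r − 1, …, 1): deleting its first row leaves a 2-core, by
-- induction a staircase, and a first row of any length other than r + 1 on top of the
-- staircase with r rows contains a hook of length 2. Staircase sizes r(r + 1)/2 increase
-- strictly, so c₂(n) = 1 exactly for triangular n.
--
-- A self-conjugate diagram ν with first row a + 1 is a hook of arm and leg a wrapped around
-- the diagram μ left after deleting its first row and column; μ is again a self-conjugate
-- 3-core, with m ≤ a rows. The first row of ν has hooks a − m, …, 1 beyond column m + 1,
-- so a ≤ m + 2, and if m ≢ 2 (mod 3) the hooks 2a + 1 and a + m at the cells (1, 1),
-- (1, 2) rule out a ∈ {m, m + 1} unless ν = (1). Hence the self-conjugate 3-cores are the
-- diagrams built from ∅ and (1) by repeatedly wrapping a hook of arm m + 2 (which keeps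
-- m ≢ 2 (mod 3)); their sizes k(3k + 2) and (k + 1)(3k + 1) increase strictly, and these
-- are exactly the positive values of j′(3j′ ± 2).

module Submission where

open import Defs
open import Data.Nat using (ℕ; zero; suc; pred; _+_; _*_; _∸_; _/_; _≤_; _<_; _≥_; z≤n; s≤s; z<s; NonZero; >-nonZero)
open import Data.Nat.Properties
open import Data.Nat.Divisibility using (_∣_; _∤_; divides; ∣m∣n⇒∣m+n; ∣m+n∣m⇒∣n; n∣m⇒m%n≡0)
open import Data.Nat.DivMod using (_%_; m*n/n≡m; m<n⇒m%n≡m; [m+kn]%n≡m%n)
open import Data.Nat.ListAction using (sum)
open import Data.Nat.Tactic.RingSolver using (solve-∀)
open import Data.Integer using (ℤ; +_; -[1+_]; _-_) renaming (_*_ to _*ℤ_; _+_ to _+ℤ_; -_ to -ℤ_)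
import Data.Integer.Properties as ℤ
import Data.Integer.Tactic.RingSolver as ZS
open import Data.List using (List; []; _∷_; length; applyUpTo)
open import Data.List.Properties using (length-applyUpTo; filter-accept; filter-reject; filter-all)
open import Data.List.Relation.Unary.All using (All; []; _∷_)
open import Data.List.Relation.Unary.Linked using (Linked; []; [-]; _∷_) renaming (tail to linked-tail)
open import Data.Product using (Σ; ∃-syntax; _×_; _,_)
open import Data.Sum using (_⊎_; inj₁; inj₂)
open import Data.Empty using (⊥; ⊥-elim)
open import Function using (_∘_)
open import Relation.Binary.Definitions using (tri<; tri≈; tri>)
open import Relation.Binary.PropositionalEquality
open import Relation.Nullary using (yes; no; contradiction)

-- 0-indexed rows and columns: row λs i = λ_{i+1} and column λs i = λ'_{i+1}.
row : List ℕ → ℕ → ℕ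
row λs i = part λs (suc i)

column : List ℕ → ℕ → ℕ
column λs i = conjPart λs (suc i)

conjPart-accept : ∀ {k x} xs → k ≤ x → conjPart (x ∷ xs) k ≡ suc (conjPart xs k)
conjPart-accept {k} xs k≤x = cong length (filter-accept (k ≤?_) k≤x)

conjPart-reject : ∀ {k x} xs → x < k → conjPart (x ∷ xs) k ≡ conjPart xs k
conjPart-reject {k} xs x<k = cong length (filter-reject (k ≤?_) (<⇒≱ x<k))

conjPart-1 : ∀ xs → All (0 <_) xs → conjPart xs 1 ≡ length xs
conjPart-1 xs pos = cong length (filter-all (1 ≤?_) pos)

conjPart-above-head : ∀ {k x} xs → Linked _≥_ (x ∷ xs) → x < k → conjPart (x ∷ xs) k ≡ 0
conjPart-above-head [] _ x<k = conjPart-reject [] x<k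
conjPart-above-head (y ∷ xs) (y≤x ∷ sorted) x<k =
  trans (conjPart-reject (y ∷ xs) x<k) (conjPart-above-head xs sorted (≤-<-trans y≤x x<k))

part-≤-head : ∀ {x} xs → Linked _≥_ (x ∷ xs) → ∀ j → part xs j ≤ x
part-≤-head [] _ j = z≤n
part-≤-head (y ∷ xs) _ zero = z≤n
part-≤-head (y ∷ xs) (y≤x ∷ _) (suc zero) = y≤x
part-≤-head (y ∷ xs) (y≤x ∷ sorted) (suc (suc j)) = ≤-trans (part-≤-head xs sorted (suc j)) y≤x

part-≤-first : ∀ xs → Linked _≥_ xs → ∀ j → part xs j ≤ part xs 1
part-≤-first [] _ j = z≤n
part-≤-first (x ∷ xs) _ zero = z≤n
part-≤-first (x ∷ xs) _ (suc zero) = ≤-refl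
part-≤-first (x ∷ xs) sorted (suc (suc j)) = part-≤-head xs sorted (suc j)

conjPart-pos⇒≤-first : ∀ {k} xs → Linked _≥_ xs → 0 < conjPart xs k → k ≤ part xs 1
conjPart-pos⇒≤-first {k} (x ∷ xs) sorted pos with k ≤? x
... | yes k≤x = k≤x
... | no k≰x = contradiction (conjPart-above-head xs sorted (≰⇒> k≰x)) (>⇒≢ pos)

part-beyond-length : ∀ xs j → length xs ≤ j → part xs (suc j) ≡ 0
part-beyond-length [] j _ = refl
part-beyond-length (x ∷ xs) (suc j) (s≤s l≤j) = part-beyond-length xs j l≤j

part-within-length : ∀ xs j → All (0 <_) xs → j < length xs → 0 < part xs (suc j)
part-within-length (x ∷ xs) zero (x>0 ∷ _) _ = x>0
part-within-length (x ∷ xs) (suc j) (_ ∷ pos) (s≤s j<l) = part-within-length xs j pos j<l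

part-pos⇒<length : ∀ xs j → 0 < part xs (suc j) → j < length xs
part-pos⇒<length (x ∷ xs) zero _ = s≤s z≤n
part-pos⇒<length (x ∷ xs) (suc j) pos = s≤s (part-pos⇒<length xs j pos)

≡-by-rows : ∀ xs ys → length xs ≡ length ys → (∀ i → row xs i ≡ row ys i) → xs ≡ ys
≡-by-rows [] [] _ _ = refl
≡-by-rows (x ∷ xs) (y ∷ ys) len rows =
  cong₂ _∷_ (rows 0) (≡-by-rows xs ys (suc-injective len) (rows ∘ suc))

part-applyUpTo-< : ∀ (f : ℕ → ℕ) n i → i < n → part (applyUpTo f n) (suc i) ≡ f i
part-applyUpTo-< f (suc n) zero _ = refl
part-applyUpTo-< f (suc n) (suc i) (s≤s i<n) = part-applyUpTo-< (f ∘ suc) n i i<n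

part-applyUpTo-≥ : ∀ (f : ℕ → ℕ) n i → n ≤ i → part (applyUpTo f n) (suc i) ≡ 0
part-applyUpTo-≥ f zero i _ = refl
part-applyUpTo-≥ f (suc n) (suc i) (s≤s n≤i) = part-applyUpTo-≥ (f ∘ suc) n i n≤i

Symmetric : List ℕ → Set
Symmetric λs = ∀ i → column λs i ≡ row λs i

column-beyond-first : ∀ λs → Linked _≥_ λs → ∀ i → part λs 1 ≤ i → column λs i ≡ 0
column-beyond-first λs sorted i first≤i with column λs i in eq
... | zero = refl
... | suc _ = contradiction (conjPart-pos⇒≤-first λs sorted (subst (0 <_) (sym eq) z<s)) (<⇒≱ (s≤s first≤i))

isSelfConjugate⇒symmetric : ∀ λs → Linked _≥_ λs → IsSelfConjugate λs → Symmetric λs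
isSelfConjugate⇒symmetric λs sorted self i with i <? part λs 1
... | yes i<first = sym (trans (cong (λ μ → part μ (suc i)) (sym self)) (part-applyUpTo-< _ _ i i<first))
... | no i≮first = trans (column-beyond-first λs sorted i (≮⇒≥ i≮first))
      (sym (trans (cong (λ μ → part μ (suc i)) (sym self)) (part-applyUpTo-≥ _ _ i (≮⇒≥ i≮first))))

symmetric⇒first≡length : ∀ λs → All (0 <_) λs → Symmetric λs → row λs 0 ≡ length λs
symmetric⇒first≡length λs pos sym-λ = trans (sym (sym-λ 0)) (conjPart-1 λs pos)

symmetric⇒isSelfConjugate : ∀ λs → Linked _≥_ λs → All (0 <_) λs → Symmetric λs → IsSelfConjugate λs
symmetric⇒isSelfConjugate λs sorted pos sym-λ = ≡-by-rows (conjugate λs) λs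
  (trans (length-applyUpTo _ (part λs 1)) (symmetric⇒first≡length λs pos sym-λ)) rows
  where
  rows : ∀ i → row (conjugate λs) i ≡ row λs i
  rows i with i <? part λs 1
  ... | yes i<first = trans (part-applyUpTo-< _ _ i i<first) (sym-λ i)
  ... | no i≮first = trans (part-applyUpTo-≥ _ _ i (≮⇒≥ i≮first))
        (trans (sym (column-beyond-first λs sorted i (≮⇒≥ i≮first))) (sym-λ i))

-- IsTCore with 0-indexed cells (j, k).
Core : ℕ → List ℕ → Set
Core t λs = ∀ j k → suc k ≤ row λs j → t ∤ hook λs (suc j) (suc k)

core⇒isTCore : ∀ t λs → Core t λs → IsTCore t λs
core⇒isTCore t λs core (suc j) (suc k) _ _ = core j k

isTCore⇒core : ∀ t λs → IsTCore t λs → Core t λs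
isTCore⇒core t λs core j k = core (suc j) (suc k) (s≤s z≤n) (s≤s z≤n)

core-tail : ∀ t x ys → Linked _≥_ (x ∷ ys) → Core t (x ∷ ys) → Core t ys
core-tail t x ys sorted core j k cell = subst (t ∤_) same-hook (core (suc j) k cell)
  where
  same-hook : hook (x ∷ ys) (2 + j) (suc k) ≡ hook ys (suc j) (suc k)
  same-hook = trans
    (cong (λ c → (row ys j + c + 1) ∸ (2 + j + suc k)) (conjPart-accept ys (≤-trans cell (part-≤-head ys sorted (suc j)))))
    (cong (λ r → (r + 1) ∸ (2 + j + suc k)) (+-suc (row ys j) (column ys k)))

hook-symmetric : ∀ λs → Symmetric λs → ∀ j k → hook λs (suc j) (suc k) ≡ hook λs (suc k) (suc j)
hook-symmetric λs sym-λ j k = cong₂ _∸_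
  (cong (_+ 1) (begin
    row λs j + column λs k     ≡⟨ cong₂ _+_ (sym (sym-λ j)) (sym-λ k) ⟩
    column λs j + row λs k     ≡⟨ +-comm (column λs j) (row λs k) ⟩
    row λs k + column λs j     ∎))
  (+-comm (suc j) (suc k))
  where open ≡-Reasoning

hook-inner : ∀ λs μ j k → row λs (suc j) ≡ suc (row μ j) → column λs (suc k) ≡ suc (column μ k)
  → hook λs (2 + j) (2 + k) ≡ hook μ (suc j) (suc k)
hook-inner λs μ j k row≡ column≡ = trans
  (cong₂ (λ r c → (r + c + 1) ∸ (2 + j + (2 + k))) row≡ column≡)
  (cong₂ _∸_ (shift-sum (row μ j) (column μ k)) (shift-cell j k))
  where
  shift-sum : ∀ a b → suc a + suc b + 1 ≡ 2 + (a + b + 1)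
  shift-sum = solve-∀
  shift-cell : ∀ a b → 2 + a + (2 + b) ≡ 2 + (suc a + suc b)
  shift-cell = solve-∀

∤-by-remainder : ∀ t r q x .{{_ : NonZero t}} → 0 < r → r < t → x ≡ r + q * t → t ∤ x
∤-by-remainder t r q x 0<r r<t refl t∣x = >⇒≢ 0<r (begin
  r                ≡⟨ m<n⇒m%n≡m r<t ⟨
  r % t            ≡⟨ [m+kn]%n≡m%n r q t ⟨
  (r + q * t) % t  ≡⟨ n∣m⇒m%n≡0 _ t t∣x ⟩
  0                ∎)
  where open ≡-Reasoning

strictMono⇒< : (f : ℕ → ℕ) → (∀ k → f k < f (suc k)) → ∀ {a b} → a < b → f a < f b
strictMono⇒< f mono {a} (s≤s a≤b) with m≤n⇒m<n∨m≡n a≤b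
... | inj₁ a<b = <-trans (strictMono⇒< f mono a<b) (mono _)
... | inj₂ refl = mono a

strictMono⇒injective : (f : ℕ → ℕ) → (∀ k → f k < f (suc k)) → ∀ {a b} → f a ≡ f b → a ≡ b
strictMono⇒injective f mono {a} {b} fa≡fb with <-cmp a b
... | tri< a<b _ _ = contradiction fa≡fb (<⇒≢ (strictMono⇒< f mono a<b))
... | tri≈ _ a≡b _ = a≡b
... | tri> _ _ b<a = contradiction (sym fa≡fb) (<⇒≢ (strictMono⇒< f mono b<a))

staircase : ℕ → List ℕ
staircase zero = []
staircase (suc r) = suc r ∷ staircase r

staircase-sorted : ∀ r → Linked _≥_ (staircase r)
staircase-sorted zero = []
staircase-sorted (suc zero) = [-]
staircase-sorted (suc (suc r)) = n≤1+n (suc r) ∷ staircase-sorted (suc r)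

staircase-positive : ∀ r → All (0 <_) (staircase r)
staircase-positive zero = []
staircase-positive (suc r) = z<s ∷ staircase-positive r

row-staircase : ∀ r i → row (staircase r) i ≡ r ∸ i
row-staircase zero i = sym (0∸n≡0 i)
row-staircase (suc r) zero = refl
row-staircase (suc r) (suc i) = row-staircase r i

column-staircase : ∀ r i → column (staircase r) i ≡ r ∸ i
column-staircase zero i = sym (0∸n≡0 i)
column-staircase (suc r) i with i ≤? r
... | yes i≤r = trans (conjPart-accept (staircase r) (s≤s i≤r))
                  (trans (cong suc (column-staircase r i)) (sym (+-∸-assoc 1 i≤r)))
... | no i≰r = trans (conjPart-reject (staircase r) (s≤s (≰⇒> i≰r)))
                 (trans (column-staircase r i) (trans (m≤n⇒m∸n≡0 (<⇒≤ (≰⇒> i≰r))) (sym (m≤n⇒m∸n≡0 (≰⇒> i≰r)))))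

sum-staircase : ∀ r → 2 * sum (staircase r) ≡ r * suc r
sum-staircase zero = refl
sum-staircase (suc r) = begin
  2 * (suc r + sum (staircase r))    ≡⟨ *-distribˡ-+ 2 (suc r) _ ⟩
  2 * suc r + 2 * sum (staircase r)  ≡⟨ cong (_+_ (2 * suc r)) (sum-staircase r) ⟩
  2 * suc r + r * suc r              ≡⟨ factor r ⟩
  suc r * suc (suc r)                ∎
  where
  open ≡-Reasoning
  factor : ∀ r → 2 * suc r + r * suc r ≡ suc r * suc (suc r)
  factor = solve-∀

sum-staircase-< : ∀ r → sum (staircase r) < sum (staircase (suc r))
sum-staircase-< r = s≤s (m≤n+m (sum (staircase r)) r)

triangular≡sum-staircase : ∀ r → (r * suc r) / 2 ≡ sum (staircase r)
triangular≡sum-staircase r = begin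
  (r * suc r) / 2                  ≡⟨ cong (_/ 2) (sum-staircase r) ⟨
  (2 * sum (staircase r)) / 2      ≡⟨ cong (_/ 2) (*-comm 2 (sum (staircase r))) ⟩
  (sum (staircase r) * 2) / 2      ≡⟨ m*n/n≡m (sum (staircase r)) 2 ⟩
  sum (staircase r)                ∎
  where open ≡-Reasoning

hook-staircase : ∀ j k e → hook (staircase (j + suc k + e)) (suc j) (suc k) ≡ suc (e + e)
hook-staircase j k e = begin
  (row (staircase r) j + column (staircase r) k + 1) ∸ (suc j + suc k)
    ≡⟨ cong₂ (λ a b → (a + b + 1) ∸ (suc j + suc k)) (row-staircase r j) (column-staircase r k) ⟩
  ((r ∸ j) + (r ∸ k) + 1) ∸ (suc j + suc k)
    ≡⟨ cong₂ (λ a b → (a + b + 1) ∸ (suc j + suc k)) (arm j k e) (leg j k e) ⟩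
  ((suc k + e) + (suc j + e) + 1) ∸ (suc j + suc k)
    ≡⟨ cong (_∸ (suc j + suc k)) (regroup j k e) ⟩
  (suc (e + e) + (suc j + suc k)) ∸ (suc j + suc k)
    ≡⟨ m+n∸n≡m (suc (e + e)) (suc j + suc k) ⟩
  suc (e + e) ∎
  where
  open ≡-Reasoning
  r = j + suc k + e
  arm : ∀ j k e → (j + suc k + e) ∸ j ≡ suc k + e
  arm j k e = trans (cong (_∸ j) (+-assoc j (suc k) e)) (m+n∸m≡n j (suc k + e))
  leg : ∀ j k e → (j + suc k + e) ∸ k ≡ suc j + e
  leg j k e = trans (cong (_∸ k) (swap j k e)) (m+n∸m≡n k (suc j + e))
    where
    swap : ∀ j k e → j + suc k + e ≡ k + (suc j + e)
    swap = solve-∀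
  regroup : ∀ j k e → suc k + e + (suc j + e) + 1 ≡ suc (e + e) + (suc j + suc k)
  regroup = solve-∀

2∤odd : ∀ e → 2 ∤ suc (e + e)
2∤odd e = ∤-by-remainder 2 1 e (suc (e + e)) z<s (s≤s (s≤s z≤n)) (odd e)
  where
  odd : ∀ e → suc (e + e) ≡ 1 + e * 2
  odd = solve-∀

staircase-core : ∀ r → Core 2 (staircase r)
staircase-core r j k cell = subst (λ s → 2 ∤ hook (staircase s) (suc j) (suc k)) r≡
  (subst (2 ∤_) (sym (hook-staircase j k e)) (2∤odd e))
  where
  cell′ : suc k ≤ r ∸ j
  cell′ = subst (suc k ≤_) (row-staircase r j) cell
  j≤r : j ≤ r
  j≤r with j ≤? r
  ... | yes j≤r = j≤r
  ... | no j≰r = contradiction (subst (suc k ≤_) (m≤n⇒m∸n≡0 (<⇒≤ (≰⇒> j≰r))) cell′) λ ()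
  e = (r ∸ j) ∸ suc k
  r≡ : j + suc k + e ≡ r
  r≡ = trans (+-assoc j (suc k) e) (trans (cong (_+_ j) (m+[n∸m]≡n cell′)) (m+[n∸m]≡n j≤r))

2∣first-row-hook : ∀ λs k → part λs 1 + conjPart λs (suc k) ≡ 2 + suc k → 2 ∣ hook λs 1 (suc k)
2∣first-row-hook λs k arm+leg = divides 1 (begin
  (part λs 1 + conjPart λs (suc k) + 1) ∸ (2 + k)  ≡⟨ cong (λ s → (s + 1) ∸ (2 + k)) arm+leg ⟩
  (3 + k + 1) ∸ (2 + k)                            ≡⟨ cong (_∸ (2 + k)) (shuffle k) ⟩
  (2 + (2 + k)) ∸ (2 + k)                          ≡⟨ m+n∸n≡m 2 (2 + k) ⟩
  2                                                ∎)
  where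
  open ≡-Reasoning
  shuffle : ∀ k → 3 + k + 1 ≡ 2 + (2 + k)
  shuffle = solve-∀

2∣hook-repeated-row : ∀ r → 2 ∣ hook (suc r ∷ staircase (suc r)) 1 (suc r)
2∣hook-repeated-row r = 2∣first-row-hook (suc r ∷ staircase (suc r)) r (begin
  suc r + conjPart (suc r ∷ staircase (suc r)) (suc r)
    ≡⟨ cong (_+_ (suc r)) (conjPart-accept {suc r} (staircase (suc r)) ≤-refl) ⟩
  suc r + suc (column (staircase (suc r)) r)  ≡⟨ cong (λ c → suc r + suc c) (column-staircase (suc r) r) ⟩
  suc r + suc (suc r ∸ r)                    ≡⟨ cong (λ c → suc r + suc c) (m+n∸n≡m 1 r) ⟩
  suc r + 2                                  ≡⟨ +-comm (suc r) 2 ⟩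
  2 + suc r                                  ∎)
  where open ≡-Reasoning

2∣hook-long-row : ∀ r e → 2 ∣ hook (2 + (r + e) ∷ staircase r) 1 (suc (r + e))
2∣hook-long-row r e = 2∣first-row-hook (2 + (r + e) ∷ staircase r) (r + e) (begin
  2 + (r + e) + conjPart (2 + (r + e) ∷ staircase r) (suc (r + e))
    ≡⟨ cong (_+_ (2 + (r + e))) (conjPart-accept {suc (r + e)} (staircase r) (n≤1+n _)) ⟩
  2 + (r + e) + suc (column (staircase r) (r + e))  ≡⟨ cong (λ c → 2 + (r + e) + suc c) (column-staircase r (r + e)) ⟩
  2 + (r + e) + suc (r ∸ (r + e))                  ≡⟨ cong (λ c → 2 + (r + e) + suc c) (m≤n⇒m∸n≡0 (m≤m+n r e)) ⟩
  2 + (r + e) + 1                                  ≡⟨ +-comm (2 + (r + e)) 1 ⟩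
  2 + suc (r + e)                                  ∎)
  where open ≡-Reasoning

core₂-head : ∀ x r → Linked _≥_ (x ∷ staircase r) → 0 < x → Core 2 (x ∷ staircase r) → x ≡ suc r
core₂-head x r sorted 0<x core with <-cmp x (suc r)
... | tri≈ _ x≡1+r _ = x≡1+r
... | tri< x<1+r _ _ = contradiction (≤-antisym (≤-pred x<1+r) r≤x) (x≢r x r 0<x core)
  where
  r≤x : r ≤ x
  r≤x = subst (_≤ x) (row-staircase r 0) (part-≤-head (staircase r) sorted 1)
  x≢r : ∀ x r → 0 < x → Core 2 (x ∷ staircase r) → x ≢ r
  x≢r (suc r′) .(suc r′) _ core refl = core 0 r′ ≤-refl (2∣hook-repeated-row r′)
... | tri> _ _ 1+r<x = contradiction (subst (λ x → 2 ∣ hook (x ∷ staircase r) 1 (suc (r + e))) (sym x≡) (2∣hook-long-row r e))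
                         (core 0 (r + e) (subst (suc (r + e) ≤_) (sym x≡) (n≤1+n _)))
  where
  e = x ∸ suc (suc r)
  x≡ : x ≡ 2 + (r + e)
  x≡ = sym (m+[n∸m]≡n 1+r<x)

core₂⇒staircase : ∀ ν → Linked _≥_ ν → All (0 <_) ν → Core 2 ν → ν ≡ staircase (length ν)
core₂⇒staircase [] _ _ _ = refl
core₂⇒staircase (x ∷ ys) sorted (0<x ∷ pos) core =
  trans (cong (x ∷_) ys≡) (cong (_∷ staircase (length ys)) x≡)
  where
  ys≡ : ys ≡ staircase (length ys)
  ys≡ = core₂⇒staircase ys (linked-tail sorted) pos (core-tail 2 x ys sorted core)
  x≡ : x ≡ suc (length ys)
  x≡ = core₂-head x (length ys) (subst (λ zs → Linked _≥_ (x ∷ zs)) ys≡ sorted) 0<x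
         (subst (λ zs → Core 2 (x ∷ zs)) ys≡ core)

c₂-staircase : ∀ r → cEqOne 2 (sum (staircase r))
c₂-staircase r = staircase r
  , ((staircase-sorted r , staircase-positive r , refl) , core⇒isTCore 2 (staircase r) (staircase-core r))
  , unique
  where
  unique : ∀ ν → IsPartitionOf ν (sum (staircase r)) → IsTCore 2 ν → ν ≡ staircase r
  unique ν (sorted , pos , sum≡) core = trans ν≡ (cong staircase length≡)
    where
    ν≡ = core₂⇒staircase ν sorted pos (isTCore⇒core 2 ν core)
    length≡ : length ν ≡ r
    length≡ = strictMono⇒injective (sum ∘ staircase) sum-staircase-< (trans (cong sum (sym ν≡)) sum≡)

growRows : List ℕ → List ℕ
growRows [] = 1 ∷ 1 ∷ []
growRows (y ∷ ys) = suc y ∷ growRows ys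

-- For symmetric μ with m = length μ rows (hence first row m), this wraps a hook with
-- arm and leg m + 2 around μ, adding 2m + 5 cells.
addHook : List ℕ → List ℕ
addHook μ = (3 + length μ) ∷ growRows μ

length-growRows : ∀ μ → length (growRows μ) ≡ 2 + length μ
length-growRows [] = refl
length-growRows (y ∷ ys) = cong suc (length-growRows ys)

sum-growRows : ∀ μ → sum (growRows μ) ≡ 2 + length μ + sum μ
sum-growRows [] = refl
sum-growRows (y ∷ ys) = trans (cong (_+_ (suc y)) (sum-growRows ys)) (regroup y (length ys) (sum ys))
  where
  regroup : ∀ y l s → suc y + (2 + l + s) ≡ 2 + suc l + (y + s)
  regroup = solve-∀

growRows-positive : ∀ μ → All (0 <_) (growRows μ)
growRows-positive [] = z<s ∷ z<s ∷ []
growRows-positive (y ∷ ys) = z<s ∷ growRows-positive ys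

growRows-sorted : ∀ μ → Linked _≥_ μ → Linked _≥_ (growRows μ)
growRows-sorted [] _ = ≤-refl ∷ [-]
growRows-sorted (y ∷ []) _ = s≤s z≤n ∷ ≤-refl ∷ [-]
growRows-sorted (y ∷ y′ ∷ ys) (y′≤y ∷ sorted) = s≤s y′≤y ∷ growRows-sorted (y′ ∷ ys) sorted

row-growRows-≤ : ∀ μ i → i ≤ suc (length μ) → row (growRows μ) i ≡ suc (row μ i)
row-growRows-≤ [] zero _ = refl
row-growRows-≤ [] (suc zero) _ = refl
row-growRows-≤ [] (suc (suc i)) (s≤s ())
row-growRows-≤ (y ∷ ys) zero _ = refl
row-growRows-≤ (y ∷ ys) (suc i) (s≤s i≤) = row-growRows-≤ ys i i≤

row-growRows-> : ∀ μ i → suc (length μ) < i → row (growRows μ) i ≡ 0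
row-growRows-> [] (suc zero) (s≤s ())
row-growRows-> [] (suc (suc i)) _ = refl
row-growRows-> (y ∷ ys) (suc i) (s≤s i>) = row-growRows-> ys i i>

column-growRows : ∀ μ i → column (growRows μ) (suc i) ≡ column μ i
column-growRows [] i = trans (conjPart-reject {2 + i} (1 ∷ []) (s≤s z<s)) (conjPart-reject {2 + i} [] (s≤s z<s))
column-growRows (y ∷ ys) i with suc i ≤? y
... | yes i<y = trans (conjPart-accept (growRows ys) (s≤s i<y))
                  (trans (cong suc (column-growRows ys i)) (sym (conjPart-accept ys i<y)))
... | no i≮y = trans (conjPart-reject (growRows ys) (s≤s (≰⇒> i≮y)))
                 (trans (column-growRows ys i) (sym (conjPart-reject ys (≰⇒> i≮y))))

length-addHook : ∀ μ → length (addHook μ) ≡ 3 + length μ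
length-addHook μ = cong suc (length-growRows μ)

sum-addHook : ∀ μ → sum (addHook μ) ≡ sum μ + (2 * length μ + 5)
sum-addHook μ = trans (cong (_+_ (3 + length μ)) (sum-growRows μ)) (regroup (length μ) (sum μ))
  where
  regroup : ∀ l s → 3 + l + (2 + l + s) ≡ s + (2 * l + 5)
  regroup = solve-∀

addHook-positive : ∀ μ → All (0 <_) (addHook μ)
addHook-positive μ = z<s ∷ growRows-positive μ

addHook-sorted : ∀ μ → Linked _≥_ μ → All (0 <_) μ → Symmetric μ → Linked _≥_ (addHook μ)
addHook-sorted [] _ _ _ = s≤s z≤n ∷ growRows-sorted [] []
addHook-sorted (y ∷ ys) sorted pos sym-μ =
  s≤s (≤-trans (≤-reflexive (symmetric⇒first≡length (y ∷ ys) pos sym-μ)) (m≤n+m _ 2))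
  ∷ growRows-sorted (y ∷ ys) sorted

column-addHook-0 : ∀ μ → column (addHook μ) 0 ≡ 3 + length μ
column-addHook-0 μ = trans (conjPart-1 (addHook μ) (addHook-positive μ)) (length-addHook μ)

column-addHook-≤ : ∀ μ i → i ≤ suc (length μ) → column (addHook μ) (suc i) ≡ suc (column μ i)
column-addHook-≤ μ i i≤ = trans (conjPart-accept (growRows μ) (s≤s (s≤s i≤))) (cong suc (column-growRows μ i))

column-addHook-> : ∀ μ i → suc (length μ) < i → column (addHook μ) (suc i) ≡ column μ i
column-addHook-> μ i i> = trans (conjPart-reject (growRows μ) (s≤s (s≤s i>))) (column-growRows μ i)

addHook-symmetric : ∀ μ → Symmetric μ → Symmetric (addHook μ)
addHook-symmetric μ sym-μ zero = column-addHook-0 μ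
addHook-symmetric μ sym-μ (suc i) with i ≤? suc (length μ)
... | yes i≤ = trans (column-addHook-≤ μ i i≤) (trans (cong suc (sym-μ i)) (sym (row-growRows-≤ μ i i≤)))
... | no i≰ = trans (column-addHook-> μ i (≰⇒> i≰))
                (trans (sym-μ i) (trans (part-beyond-length μ i (<⇒≤ (<-trans (n<1+n _) (≰⇒> i≰))))
                  (sym (row-growRows-> μ i (≰⇒> i≰)))))

3∤-between : ∀ {x} → 0 < x → x < 3 → 3 ∤ x
3∤-between {x} 0<x x<3 = ∤-by-remainder 3 x 0 x 0<x x<3 (sym (+-identityʳ x))

3∤⇒3∤3+ : ∀ {x} → 3 ∤ x → 3 ∤ 3 + x
3∤⇒3∤3+ 3∤x 3∣3+x = 3∤x (∣m+n∣m⇒∣n 3∣3+x (divides 1 refl))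

3∤3+⇒3∤ : ∀ {x} → 3 ∤ 3 + x → 3 ∤ x
3∤3+⇒3∤ 3∤3+x 3∣x = 3∤3+x (∣m∣n⇒∣m+n (divides 1 refl) 3∣x)

3∤⇒3∤x+x : ∀ {x} → 3 ∤ x → 3 ∤ x + x
3∤⇒3∤x+x {x} 3∤x 3∣2x = 3∤x (∣m+n∣m⇒∣n (divides x (triple x)) 3∣2x)
  where
  triple : ∀ x → x + x + x ≡ x * 3
  triple = solve-∀

3∣-consecutive : ∀ x → 3 ∤ x → 3 ∤ suc x → 3 ∣ 2 + x
3∣-consecutive 0 3∤0 _ = contradiction (divides 0 refl) 3∤0
3∣-consecutive 1 _ _ = divides 1 refl
3∣-consecutive 2 _ 3∤3 = contradiction (divides 1 refl) 3∤3
3∣-consecutive (suc (suc (suc x))) 3∤3+x 3∤4+x =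
  ∣m∣n⇒∣m+n (divides 1 refl) (3∣-consecutive x (3∤3+⇒3∤ 3∤3+x) (3∤3+⇒3∤ 3∤4+x))

-- hookAbove μ k is the hook length of the cell (1, k + 2) of addHook μ.
hookAbove : List ℕ → ℕ → ℕ
hookAbove μ k = (length μ + column μ k + 2) ∸ k

Extendable : List ℕ → Set
Extendable μ = ∀ k → k < length μ → 3 ∤ hookAbove μ k

hook-addHook-first-row : ∀ μ i → i ≤ suc (length μ) → hook (addHook μ) 1 (2 + i) ≡ hookAbove μ i
hook-addHook-first-row μ i i≤ = begin
  (3 + m + column (addHook μ) (suc i) + 1) ∸ (3 + i)  ≡⟨ cong (λ c → (3 + m + c + 1) ∸ (3 + i)) (column-addHook-≤ μ i i≤) ⟩
  (m + suc (column μ i) + 1) ∸ i                      ≡⟨ cong (_∸ i) (shuffle m (column μ i)) ⟩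
  hookAbove μ i                                       ∎
  where
  open ≡-Reasoning
  m = length μ
  shuffle : ∀ m c → m + suc c + 1 ≡ m + c + 2
  shuffle = solve-∀

hookAbove-addHook : ∀ μ i → i ≤ suc (length μ) → hookAbove (addHook μ) (suc i) ≡ 3 + hookAbove μ i
hookAbove-addHook μ i i≤ = begin
  (length (addHook μ) + column (addHook μ) (suc i) + 2) ∸ suc i
    ≡⟨ cong₂ (λ l c → (l + c + 2) ∸ suc i) (length-addHook μ) (column-addHook-≤ μ i i≤) ⟩
  (2 + m + suc c + 2) ∸ i    ≡⟨ cong (_∸ i) (shuffle m c) ⟩
  (3 + (m + c + 2)) ∸ i      ≡⟨ +-∸-assoc 3 (≤-trans i≤ (m+1≤m+c+2 m c)) ⟩
  3 + hookAbove μ i          ∎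
  where
  open ≡-Reasoning
  m = length μ
  c = column μ i
  shuffle : ∀ m c → 2 + m + suc c + 2 ≡ 3 + (m + c + 2)
  shuffle = solve-∀
  m+1≤m+c+2 : ∀ m c → suc m ≤ m + c + 2
  m+1≤m+c+2 m c = subst (suc m ≤_) (shuffle′ m c) (m≤m+n (suc m) (suc c))
    where
    shuffle′ : ∀ m c → suc m + suc c ≡ m + c + 2
    shuffle′ = solve-∀

hookAbove-free : ∀ μ → Symmetric μ → Extendable μ → ∀ k → k ≤ suc (length μ) → 3 ∤ hookAbove μ k
hookAbove-free μ sym-μ ext k k≤ with k <? length μ
... | yes k<m = ext k k<m
... | no k≮m = subst (3 ∤_) (sym value≡) (3∤-between (m<n⇒0<n∸m (s≤s k≤)) (s≤s small))
  where
  m = length μ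
  value≡ : hookAbove μ k ≡ (2 + m) ∸ k
  value≡ = trans (cong (λ c → (m + c + 2) ∸ k) (trans (sym-μ k) (part-beyond-length μ k (≮⇒≥ k≮m))))
                 (cong (_∸ k) (shuffle m))
    where
    shuffle : ∀ m → m + 0 + 2 ≡ 2 + m
    shuffle = solve-∀
  small : (2 + m) ∸ k ≤ 2
  small = ≤-trans (∸-monoʳ-≤ (2 + m) (≮⇒≥ k≮m)) (≤-reflexive (m+n∸n≡m 2 m))

module _ (μ : List ℕ) (sorted : Linked _≥_ μ) (pos : All (0 <_) μ) (sym-μ : Symmetric μ)
         (ext : Extendable μ) (3∤1+m : 3 ∤ suc (length μ)) where

  private
    m = length μ

    3∤2+2m : 3 ∤ suc m + suc m
    3∤2+2m = 3∤⇒3∤x+x 3∤1+m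

  addHook-first-row : ∀ k → suc k ≤ 3 + m → 3 ∤ hook (addHook μ) 1 (suc k)
  addHook-first-row zero _ = subst (3 ∤_) (sym corner) (3∤⇒3∤3+ 3∤2+2m)
    where
    shuffle : ∀ m → 3 + m + (3 + m) + 1 ≡ 2 + (3 + (suc m + suc m))
    shuffle = solve-∀
    corner : hook (addHook μ) 1 1 ≡ 3 + (suc m + suc m)
    corner = trans (cong (λ c → (3 + m + c + 1) ∸ 2) (column-addHook-0 μ))
                   (trans (cong (_∸ 2) (shuffle m)) (m+n∸m≡n 2 _))
  addHook-first-row (suc i) (s≤s (s≤s i≤)) =
    subst (3 ∤_) (sym (hook-addHook-first-row μ i i≤)) (hookAbove-free μ sym-μ ext i i≤)

  addHook-core : Core 3 μ → Core 3 (addHook μ)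
  addHook-core _ zero k cell = addHook-first-row k cell
  addHook-core _ (suc j) zero cell =
    subst (3 ∤_) (sym (hook-symmetric (addHook μ) (addHook-symmetric μ sym-μ) (suc j) 0))
      (addHook-first-row (suc j) (conjPart-pos⇒≤-first (addHook μ) (addHook-sorted μ sorted pos sym-μ)
        (subst (0 <_) (sym (addHook-symmetric μ sym-μ (suc j))) cell)))
  addHook-core core-μ (suc j) (suc k) cell with j ≤? suc m
  ... | no j≰ = contradiction (subst (2 + k ≤_) (row-growRows-> μ j (≰⇒> j≰)) cell) λ ()
  ... | yes j≤ = subst (3 ∤_) (sym (hook-inner (addHook μ) μ j k (row-growRows-≤ μ j j≤) (column-addHook-≤ μ k k≤)))
                   (core-μ j k cell′)
    where
    cell′ : suc k ≤ row μ j
    cell′ = ≤-pred (subst (2 + k ≤_) (row-growRows-≤ μ j j≤) cell)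
    k≤ : k ≤ suc m
    k≤ = ≤-trans (<⇒≤ (≤-trans cell′ (part-≤-first μ sorted (suc j))))
           (≤-trans (≤-reflexive (symmetric⇒first≡length μ pos sym-μ)) (n≤1+n m))

  addHook-extendable : Extendable (addHook μ)
  addHook-extendable zero _ = subst (3 ∤_) (sym corner) (3∤⇒3∤3+ (3∤⇒3∤3+ 3∤2+2m))
    where
    shuffle : ∀ m → 3 + m + (3 + m) + 2 ≡ 3 + (3 + (suc m + suc m))
    shuffle = solve-∀
    corner : hookAbove (addHook μ) 0 ≡ 3 + (3 + (suc m + suc m))
    corner = trans (cong₂ (λ l c → l + c + 2) (length-addHook μ) (column-addHook-0 μ)) (shuffle m)
  addHook-extendable (suc i) i< = subst (3 ∤_) (sym (hookAbove-addHook μ i i≤)) (3∤⇒3∤3+ (hookAbove-free μ sym-μ ext i i≤))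
    where
    i≤ : i ≤ suc m
    i≤ = ≤-pred (≤-pred (subst (suc (suc i) ≤_) (length-addHook μ) i<))

dropFirstColumn : List ℕ → List ℕ
dropFirstColumn [] = []
dropFirstColumn (zero ∷ _) = []
dropFirstColumn (suc zero ∷ _) = []
dropFirstColumn (suc (suc y) ∷ ys) = suc y ∷ dropFirstColumn ys

pred-≤1 : ∀ {x} → x ≤ 1 → pred x ≡ 0
pred-≤1 z≤n = refl
pred-≤1 (s≤s z≤n) = refl

row-dropFirstColumn : ∀ ys → Linked _≥_ ys → ∀ i → row (dropFirstColumn ys) i ≡ pred (row ys i)
row-dropFirstColumn [] _ i = refl
row-dropFirstColumn (zero ∷ ys) _ zero = refl
row-dropFirstColumn (zero ∷ ys) sorted (suc i) = sym (pred-≤1 (≤-trans (part-≤-head ys sorted (suc i)) z≤n))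
row-dropFirstColumn (suc zero ∷ ys) _ zero = refl
row-dropFirstColumn (suc zero ∷ ys) sorted (suc i) = sym (pred-≤1 (part-≤-head ys sorted (suc i)))
row-dropFirstColumn (suc (suc y) ∷ ys) _ zero = refl
row-dropFirstColumn (suc (suc y) ∷ ys) sorted (suc i) = row-dropFirstColumn ys (linked-tail sorted) i

column-dropFirstColumn : ∀ ys → Linked _≥_ ys → ∀ k → column (dropFirstColumn ys) k ≡ column ys (suc k)
column-dropFirstColumn [] _ k = refl
column-dropFirstColumn (zero ∷ ys) sorted k = sym (conjPart-above-head ys sorted z<s)
column-dropFirstColumn (suc zero ∷ ys) sorted k = sym (conjPart-above-head ys sorted (s≤s z<s))
column-dropFirstColumn (suc (suc y) ∷ ys) sorted k with suc k ≤? suc y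
... | yes k<y = trans (conjPart-accept (dropFirstColumn ys) k<y)
                  (trans (cong suc (column-dropFirstColumn ys (linked-tail sorted) k)) (sym (conjPart-accept ys (s≤s k<y))))
... | no k≮y = trans (conjPart-reject (dropFirstColumn ys) (≰⇒> k≮y))
                 (trans (column-dropFirstColumn ys (linked-tail sorted) k) (sym (conjPart-reject ys (s≤s (≰⇒> k≮y)))))

dropFirstColumn-sorted : ∀ ys → Linked _≥_ ys → Linked _≥_ (dropFirstColumn ys)
dropFirstColumn-sorted [] _ = []
dropFirstColumn-sorted (zero ∷ ys) _ = []
dropFirstColumn-sorted (suc zero ∷ ys) _ = []
dropFirstColumn-sorted (suc (suc y) ∷ []) _ = [-]
dropFirstColumn-sorted (suc (suc y) ∷ zero ∷ ys) _ = [-]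
dropFirstColumn-sorted (suc (suc y) ∷ suc zero ∷ ys) _ = [-]
dropFirstColumn-sorted (suc (suc y) ∷ suc (suc y′) ∷ ys) (s≤s y′≤y ∷ sorted) =
  y′≤y ∷ dropFirstColumn-sorted (suc (suc y′) ∷ ys) sorted

dropFirstColumn-positive : ∀ ys → All (0 <_) (dropFirstColumn ys)
dropFirstColumn-positive [] = []
dropFirstColumn-positive (zero ∷ ys) = []
dropFirstColumn-positive (suc zero ∷ ys) = []
dropFirstColumn-positive (suc (suc y) ∷ ys) = z<s ∷ dropFirstColumn-positive ys

length-dropFirstColumn : ∀ ys → length (dropFirstColumn ys) ≤ length ys
length-dropFirstColumn [] = z≤n
length-dropFirstColumn (zero ∷ ys) = z≤n
length-dropFirstColumn (suc zero ∷ ys) = z≤n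
length-dropFirstColumn (suc (suc y) ∷ ys) = s≤s (length-dropFirstColumn ys)

module Peel (x : ℕ) (ys : List ℕ) (sorted : Linked _≥_ (x ∷ ys)) (pos : All (0 <_) (x ∷ ys))
            (sym-ν : Symmetric (x ∷ ys)) where

  ν μ : List ℕ
  ν = x ∷ ys
  μ = dropFirstColumn ys

  a m : ℕ
  a = length ys
  m = length μ

  private
    sorted-ys : Linked _≥_ ys
    sorted-ys = linked-tail sorted

    pos-ys : All (0 <_) ys
    pos-ys = Data.List.Relation.Unary.All.tail pos

  m≤a : m ≤ a
  m≤a = length-dropFirstColumn ys

  x≡1+a : x ≡ suc a
  x≡1+a = symmetric⇒first≡length ν pos sym-ν

  row-ν-inner : ∀ i → i < a → row ν (suc i) ≡ suc (row μ i)
  row-ν-inner i i<a = begin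
    row ys i               ≡⟨ suc-pred (row ys i) {{>-nonZero (part-within-length ys i pos-ys i<a)}} ⟨
    suc (pred (row ys i))  ≡⟨ cong suc (row-dropFirstColumn ys sorted-ys i) ⟨
    suc (row μ i)          ∎
    where open ≡-Reasoning

  peel-symmetric : Symmetric μ
  peel-symmetric k = begin
    column μ k                  ≡⟨ column-dropFirstColumn ys sorted-ys k ⟩
    column ys (suc k)           ≡⟨ column-tail ⟩
    pred (column ν (suc k))     ≡⟨ cong pred (sym-ν (suc k)) ⟩
    pred (row ys k)             ≡⟨ row-dropFirstColumn ys sorted-ys k ⟨
    row μ k                     ∎
    where
    open ≡-Reasoning
    column-tail : column ys (suc k) ≡ pred (column ν (suc k))
    column-tail with 2 + k ≤? x
    ... | yes k<x = cong pred (sym (conjPart-accept ys k<x))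
    ... | no k≮x = trans (sym (conjPart-reject ys (≰⇒> k≮x))) (trans empty (cong pred (sym empty)))
      where
      empty : column ν (suc k) ≡ 0
      empty = conjPart-above-head ys sorted (≰⇒> k≮x)

  peel-core : Core 3 ν → Core 3 μ
  peel-core core j k cell = subst (3 ∤_) (hook-inner ν μ j k row≡ column≡) (core (suc j) (suc k) cell′)
    where
    cell′ : 2 + k ≤ row ν (suc j)
    cell′ = pred-cancel-< (subst (suc k ≤_) (row-dropFirstColumn ys sorted-ys j) cell)
    row≡ : row ν (suc j) ≡ suc (row μ j)
    row≡ = row-ν-inner j (part-pos⇒<length ys j (<-≤-trans z<s cell′))
    column≡ : column ν (suc k) ≡ suc (column μ k)
    column≡ = trans (conjPart-accept ys (≤-trans cell′ (part-≤-head ys sorted (suc j))))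
                    (cong suc (sym (column-dropFirstColumn ys sorted-ys k)))

  hook-corner : hook ν 1 1 ≡ suc (a + a)
  hook-corner = begin
    (x + conjPart ν 1 + 1) ∸ 2    ≡⟨ cong₂ (λ r c → (r + c + 1) ∸ 2) x≡1+a (trans (sym-ν 0) x≡1+a) ⟩
    (suc a + suc a + 1) ∸ 2       ≡⟨ cong (_∸ 2) (shuffle a) ⟩
    (2 + suc (a + a)) ∸ 2         ≡⟨ m+n∸m≡n 2 (suc (a + a)) ⟩
    suc (a + a)                   ∎
    where
    open ≡-Reasoning
    shuffle : ∀ a → suc a + suc a + 1 ≡ 2 + suc (a + a)
    shuffle = solve-∀

  hook-first-row : ∀ k → k < a → hook ν 1 (2 + k) ≡ (a + row μ k) ∸ k
  hook-first-row k k<a = begin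
    (x + column ν (suc k) + 1) ∸ (3 + k)
      ≡⟨ cong₂ (λ r c → (r + c + 1) ∸ (3 + k)) x≡1+a (trans (sym-ν (suc k)) (row-ν-inner k k<a)) ⟩
    (suc a + suc (row μ k) + 1) ∸ (3 + k)       ≡⟨ cong (_∸ (3 + k)) (shuffle a (row μ k)) ⟩
    (3 + (a + row μ k)) ∸ (3 + k)               ≡⟨⟩
    (a + row μ k) ∸ k                           ∎
    where
    open ≡-Reasoning
    shuffle : ∀ a r → suc a + suc r + 1 ≡ 3 + (a + r)
    shuffle = solve-∀

  peel-gap : Core 3 ν → a ≤ 2 + m
  peel-gap core with a ≤? 2 + m
  ... | yes a≤2+m = a≤2+m
  ... | no a≰2+m = contradiction (divides 1 hook≡3) (core 0 (suc k) cell)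
    where
    3+m≤a : 3 + m ≤ a
    3+m≤a = ≰⇒> a≰2+m
    3≤a : 3 ≤ a
    3≤a = m+n≤o⇒m≤o 3 3+m≤a
    k = a ∸ 3
    k<a : k < a
    k<a = ∸-monoʳ-< z<s 3≤a
    cell : 2 + k ≤ x
    cell = subst (2 + k ≤_) (sym x≡1+a) (s≤s k<a)
    hook≡3 : hook ν 1 (2 + k) ≡ 3
    hook≡3 = begin
      hook ν 1 (2 + k)        ≡⟨ hook-first-row k k<a ⟩
      (a + row μ k) ∸ k       ≡⟨ cong (λ r → (a + r) ∸ k) (part-beyond-length μ k (∸-monoˡ-≤ 3 3+m≤a)) ⟩
      (a + 0) ∸ k             ≡⟨ cong (_∸ k) (+-identityʳ a) ⟩
      a ∸ (a ∸ 3)             ≡⟨ m∸[m∸n]≡n 3≤a ⟩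
      3                       ∎
      where open ≡-Reasoning

  peel-addHook : a ≡ 2 + m → ν ≡ addHook μ
  peel-addHook a≡ = ≡-by-rows ν (addHook μ) (trans (cong suc a≡) (sym (length-addHook μ))) rows
    where
    rows : ∀ i → row ν i ≡ row (addHook μ) i
    rows zero = trans x≡1+a (cong suc a≡)
    rows (suc i) with i <? a
    ... | yes i<a = trans (row-ν-inner i i<a) (sym (row-growRows-≤ μ i (≤-pred (subst (i <_) a≡ i<a))))
    ... | no i≮a = trans (part-beyond-length ys i (≮⇒≥ i≮a)) (sym (row-growRows-> μ i (subst (_≤ i) a≡ (≮⇒≥ i≮a))))

-- The hooks of the cells (1, 1) and (1, 2) of a peeled diagram with a ∈ {m, m + 1}.
hooks-mod3-clash : ∀ {a m} → m ≤ a → a ≤ suc m → 3 ∤ suc m → 3 ∤ suc (a + a) → 3 ∤ a + m → ⊥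
hooks-mod3-clash {a} {m} m≤a a≤1+m 3∤1+m 3∤corner 3∤next with m≤n⇒m<n∨m≡n m≤a
... | inj₂ refl = 3∤⇒3∤x+x 3∤1+m (subst (3 ∣_) (cong suc (sym (+-suc m m))) (3∣-consecutive (m + m) 3∤next 3∤corner))
... | inj₁ m<a with ≤-antisym a≤1+m m<a
...   | refl = 3∤⇒3∤x+x 3∤1+m (subst (3 ∣_) (cong suc (sym (+-suc m m)))
                 (3∣-consecutive (m + m) (3∤3+⇒3∤ (subst (3 ∤_) corner≡ 3∤corner)) 3∤next))
  where
  corner≡ : suc (suc m + suc m) ≡ 3 + (m + m)
  corner≡ = cong (_+_ 2) (+-suc m m)

record ScCoreInvariant (μ : List ℕ) : Set where
  field
    sorted : Linked _≥_ μ
    positive : All (0 <_) μ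
    symmetric : Symmetric μ
    core : Core 3 μ
    extendable : Extendable μ
    length≢2 : 3 ∤ suc (length μ)

-- scCore (2k) and scCore (2k + 1) are the self-conjugate 3-cores with 3k and 3k + 1 rows.
scCore : ℕ → List ℕ
scCore 0 = []
scCore 1 = 1 ∷ []
scCore (suc (suc t)) = addHook (scCore t)

scCore-invariant : ∀ t → ScCoreInvariant (scCore t)
scCore-invariant 0 = record
  { sorted = [] ; positive = [] ; symmetric = λ _ → refl ; core = λ _ _ ()
  ; extendable = λ _ () ; length≢2 = 3∤-between z<s (s≤s (s≤s z≤n)) }
scCore-invariant 1 = record
  { sorted = [-] ; positive = z<s ∷ [] ; symmetric = symmetric ; core = core
  ; extendable = extendable ; length≢2 = 3∤-between z<s (s≤s (s≤s (s≤s z≤n))) }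
  where
  symmetric : Symmetric (1 ∷ [])
  symmetric zero = refl
  symmetric (suc i) = conjPart-reject {2 + i} [] (s≤s z<s)
  core : Core 3 (1 ∷ [])
  core zero zero _ = 3∤-between z<s (s≤s (s≤s z≤n))
  core zero (suc k) (s≤s ())
  extendable : Extendable (1 ∷ [])
  extendable zero _ = ∤-by-remainder 3 1 1 4 z<s (s≤s (s≤s z≤n)) refl
  extendable (suc k) (s≤s ())
scCore-invariant (suc (suc t)) = record
  { sorted = addHook-sorted μ sorted positive symmetric
  ; positive = addHook-positive μ
  ; symmetric = addHook-symmetric μ symmetric
  ; core = addHook-core μ sorted positive symmetric extendable length≢2 core
  ; extendable = addHook-extendable μ sorted positive symmetric extendable length≢2
  ; length≢2 = subst (λ l → 3 ∤ suc l) (sym (length-addHook μ)) (3∤⇒3∤3+ length≢2)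
  }
  where
  μ = scCore t
  open ScCoreInvariant (scCore-invariant t)

symmetric-core₃⇒scCore : ∀ L ν → length ν ≤ L → Linked _≥_ ν → All (0 <_) ν → Symmetric ν → Core 3 ν
  → ∃[ t ] ν ≡ scCore t
symmetric-core₃⇒scCore _ [] _ _ _ _ _ = 0 , refl
symmetric-core₃⇒scCore _ (x ∷ []) _ sorted pos sym-ν _ = 1 , cong (_∷ []) (Peel.x≡1+a x [] sorted pos sym-ν)
symmetric-core₃⇒scCore (suc L) (x ∷ y ∷ ys) (s≤s l≤L) sorted pos sym-ν core = extend
  (symmetric-core₃⇒scCore L μ (≤-trans m≤a l≤L) (dropFirstColumn-sorted (y ∷ ys) (linked-tail sorted))
    (dropFirstColumn-positive (y ∷ ys)) peel-symmetric (peel-core core))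
  where
  open Peel x (y ∷ ys) sorted pos sym-ν
  3∤corner : 3 ∤ suc (a + a)
  3∤corner = subst (3 ∤_) hook-corner (core 0 0 (subst (1 ≤_) (sym x≡1+a) (s≤s z≤n)))
  3∤next : 3 ∤ a + m
  3∤next = subst (3 ∤_) next≡ (core 0 1 (subst (2 ≤_) (sym x≡1+a) (s≤s (s≤s z≤n))))
    where
    next≡ : hook ν 1 2 ≡ a + m
    next≡ = trans (hook-first-row 0 (s≤s z≤n))
      (cong (_+_ a) (symmetric⇒first≡length μ (dropFirstColumn-positive (y ∷ ys)) peel-symmetric))
  extend : ∃[ t ] μ ≡ scCore t → ∃[ t ] ν ≡ scCore t
  extend (t , μ≡) with a ≟ 2 + m
  ... | yes a≡ = suc (suc t) , trans (peel-addHook a≡) (cong addHook μ≡)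
  ... | no a≢ = ⊥-elim (hooks-mod3-clash m≤a (≤-pred (≤∧≢⇒< (peel-gap core) a≢)) 3∤1+m 3∤corner 3∤next)
    where
    3∤1+m : 3 ∤ suc m
    3∤1+m = subst (λ ρ → 3 ∤ suc (length ρ)) (sym μ≡) (ScCoreInvariant.length≢2 (scCore-invariant t))

length-scCore-≤ : ∀ t → length (scCore t) ≤ length (scCore (suc t))
length-scCore-≤ 0 = z≤n
length-scCore-≤ 1 = s≤s z≤n
length-scCore-≤ (suc (suc t)) = begin
  length (addHook (scCore t))        ≡⟨ length-addHook (scCore t) ⟩
  3 + length (scCore t)              ≤⟨ +-monoʳ-≤ 3 (length-scCore-≤ t) ⟩
  3 + length (scCore (suc t))        ≡⟨ length-addHook (scCore (suc t)) ⟨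
  length (addHook (scCore (suc t)))  ∎
  where open ≤-Reasoning

sum-scCore-< : ∀ t → sum (scCore t) < sum (scCore (suc t))
sum-scCore-< 0 = z<s
sum-scCore-< 1 = s≤s (s≤s z≤n)
sum-scCore-< (suc (suc t)) = begin-strict
  sum (addHook (scCore t))                              ≡⟨ sum-addHook (scCore t) ⟩
  sum (scCore t) + (2 * length (scCore t) + 5)          <⟨ +-mono-<-≤ (sum-scCore-< t)
                                                             (+-monoˡ-≤ 5 (*-monoʳ-≤ 2 (length-scCore-≤ t))) ⟩
  sum (scCore (suc t)) + (2 * length (scCore (suc t)) + 5)  ≡⟨ sum-addHook (scCore (suc t)) ⟨
  sum (addHook (scCore (suc t)))                        ∎
  where open ≤-Reasoning

sc₃-scCore : ∀ t → scEqOne 3 (sum (scCore t))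
sc₃-scCore t = scCore t
  , ((sorted , positive , refl) , core⇒isTCore 3 (scCore t) core , symmetric⇒isSelfConjugate (scCore t) sorted positive symmetric)
  , unique
  where
  open ScCoreInvariant (scCore-invariant t)
  unique : ∀ ν → IsPartitionOf ν (sum (scCore t)) → IsTCore 3 ν × IsSelfConjugate ν → ν ≡ scCore t
  unique ν (sorted-ν , positive-ν , sum≡) (core-ν , self-ν)
    with symmetric-core₃⇒scCore (length ν) ν ≤-refl sorted-ν positive-ν
           (isSelfConjugate⇒symmetric ν sorted-ν self-ν) (isTCore⇒core 3 ν core-ν)
  ... | t′ , ν≡ = trans ν≡ (cong scCore
          (strictMono⇒injective (sum ∘ scCore) sum-scCore-< (trans (cong sum (sym ν≡)) sum≡)))

scCore-size : ∀ k → (∃[ t ] (length (scCore t) ≡ 3 * k × sum (scCore t) ≡ k * (3 * k + 2)))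
                  × (∃[ t ] (length (scCore t) ≡ 3 * k + 1 × sum (scCore t) ≡ suc k * (3 * k + 1)))
scCore-size zero = (0 , refl , refl) , (1 , refl , refl)
scCore-size (suc k) with scCore-size k
... | (t₀ , len₀ , sum₀) , (t₁ , len₁ , sum₁) =
      (suc (suc t₀) , step-length t₀ len₀ (three k) , step-sum t₀ len₀ sum₀ (even k))
    , (suc (suc t₁) , step-length t₁ len₁ (three′ k) , step-sum t₁ len₁ sum₁ (odd k))
  where
  step-length : ∀ t {l l′} → length (scCore t) ≡ l → 3 + l ≡ l′ → length (scCore (2 + t)) ≡ l′
  step-length t len eq = trans (length-addHook (scCore t)) (trans (cong (_+_ 3) len) eq)
  step-sum : ∀ t {l s s′} → length (scCore t) ≡ l → sum (scCore t) ≡ s → s + (2 * l + 5) ≡ s′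
    → sum (scCore (2 + t)) ≡ s′
  step-sum t len sum≡ eq = trans (sum-addHook (scCore t)) (trans (cong₂ (λ s l → s + (2 * l + 5)) sum≡ len) eq)
  three : ∀ k → 3 + 3 * k ≡ 3 * suc k
  three = solve-∀
  three′ : ∀ k → 3 + (3 * k + 1) ≡ 3 * suc k + 1
  three′ = solve-∀
  even : ∀ k → k * (3 * k + 2) + (2 * (3 * k) + 5) ≡ suc k * (3 * suc k + 2)
  even = solve-∀
  odd : ∀ k → suc k * (3 * k + 1) + (2 * (3 * k + 1) + 5) ≡ suc (suc k) * (3 * suc k + 1)
  odd = solve-∀

+-j[3j+c] : ∀ j c → + (j * (3 * j + c)) ≡ + j *ℤ ((+ 3) *ℤ + j +ℤ + c)
+-j[3j+c] j c = trans (ℤ.pos-* j (3 * j + c))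
  (cong (+ j *ℤ_) (trans (ℤ.pos-+ (3 * j) c) (cong (_+ℤ + c) (ℤ.pos-* 3 j))))

+-[1+k][3k+1] : ∀ k → + (suc k * (3 * k + 1)) ≡ (+ 1 +ℤ + k) *ℤ ((+ 3) *ℤ + k +ℤ + 1)
+-[1+k][3k+1] k = trans (ℤ.pos-* (suc k) (3 * k + 1))
  (cong (+ suc k *ℤ_) (trans (ℤ.pos-+ (3 * k) 1) (cong (_+ℤ + 1) (ℤ.pos-* 3 k))))

j′[3j′±2]-naturals : ∀ n → 0 < n
  → Σ ℤ (λ j′ → (+ n ≡ j′ *ℤ ((+ 3) *ℤ j′ +ℤ + 2)) ⊎ (+ n ≡ j′ *ℤ ((+ 3) *ℤ j′ - + 2)))
  → ∃[ k ] (n ≡ k * (3 * k + 2) ⊎ n ≡ suc k * (3 * k + 1))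
j′[3j′±2]-naturals n _ (+ k , inj₁ eq) = k , inj₁ (ℤ.+-injective (trans eq (sym (+-j[3j+c] k 2))))
j′[3j′±2]-naturals n _ (-[1+ k ] , inj₁ eq) =
  k , inj₂ (ℤ.+-injective (trans eq (trans (negate (+ k)) (sym (+-[1+k][3k+1] k)))))
  where
  negate : ∀ x → -ℤ (+ 1 +ℤ x) *ℤ (+ 3 *ℤ -ℤ (+ 1 +ℤ x) +ℤ + 2) ≡ (+ 1 +ℤ x) *ℤ (+ 3 *ℤ x +ℤ + 1)
  negate = ZS.solve-∀
j′[3j′±2]-naturals n 0<n (+ zero , inj₂ eq) = contradiction (ℤ.+-injective eq) (>⇒≢ 0<n)
j′[3j′±2]-naturals n _ (+ suc k , inj₂ eq) =
  k , inj₂ (ℤ.+-injective (trans eq (trans (shift (+ k)) (sym (+-[1+k][3k+1] k)))))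
  where
  shift : ∀ x → (+ 1 +ℤ x) *ℤ (+ 3 *ℤ (+ 1 +ℤ x) - + 2) ≡ (+ 1 +ℤ x) *ℤ (+ 3 *ℤ x +ℤ + 1)
  shift = ZS.solve-∀
j′[3j′±2]-naturals n _ (-[1+ k ] , inj₂ eq) =
  suc k , inj₁ (ℤ.+-injective (trans eq (trans (negate (+ k)) (sym (+-j[3j+c] (suc k) 2)))))
  where
  negate : ∀ x → -ℤ (+ 1 +ℤ x) *ℤ (+ 3 *ℤ -ℤ (+ 1 +ℤ x) - + 2) ≡ (+ 1 +ℤ x) *ℤ (+ 3 *ℤ (+ 1 +ℤ x) +ℤ + 2)
  negate = ZS.solve-∀

j′[3j′±2]⇒sum-scCore : ∀ n → 0 < n
  → Σ ℤ (λ j′ → (+ n ≡ j′ *ℤ ((+ 3) *ℤ j′ +ℤ + 2)) ⊎ (+ n ≡ j′ *ℤ ((+ 3) *ℤ j′ - + 2)))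
  → ∃[ t ] n ≡ sum (scCore t)
j′[3j′±2]⇒sum-scCore n 0<n j′ with j′[3j′±2]-naturals n 0<n j′
... | k , inj₁ n≡ = let (t , _ , sum≡) , _ = scCore-size k in t , trans n≡ (sym sum≡)
... | k , inj₂ n≡ = let _ , (t , _ , sum≡) = scCore-size k in t , trans n≡ (sym sum≡)

mainTheorem12 : (n : ℕ) → 0 < n
    → Σ ℕ (λ j → n ≡ (j * suc j) / 2)
    → Σ ℤ (λ j′ → (+ n ≡ j′ *ℤ ((+ 3) *ℤ j′ +ℤ + 2)) ⊎ (+ n ≡ j′ *ℤ ((+ 3) *ℤ j′ - + 2)))
    → scEqOne 3 n × cEqOne 2 n
mainTheorem12 n 0<n (j , n≡) j′ with j′[3j′±2]⇒sum-scCore n 0<n j′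
... | t , n≡′ = subst (scEqOne 3) (sym n≡′) (sc₃-scCore t)
              , subst (cEqOne 2) (sym (trans n≡ (triangular≡sum-staircase j))) (c₂-staircase j)
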